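{- Let $q$ be a power of a prime $p\ge5$ and let $\lambda\in\mathbb{F}_q\setminus\{0,1\}$ with $j(E^{\mathrm{Leg}}_\lambda)=1728$. (1) If $q\equiv3\pmod4$, then $a^{\mathrm{Leg}}_\lambda(q)=0$. (2) If $q\equiv1\pmod8$, then $L(2)=\{ -1,2,1/2\}$. (3) If $q\equiv5\pmod8$, then $L(2)=\{ -1,2\}$ and $L(1/2)=\{1/2\}$.
   Context: For $\lambda\in\mathbb{F}_q\setminus\{0,1\}$, $E^{\mathrm{Leg}}_\lambda: y^2=x(x-1)(x-\lambda)$ and $a^{\mathrm{Leg}}_\lambda(q):=q+1-|E^{\mathrm{Leg}}_\lambda(\mathbb{F}_q)|$. Define $L(\lambda):=\{\beta\in\mathbb{F}_q\setminus\{0,1\}:\ E^{\mathrm{Leg}}_\beta\cong E^{\mathrm{Leg}}_\lambda \text{ over } \mathbb{F}_q\}$. (The values $\lambda$ with $j(E^{\mathrm{Leg}}_\lambda)=1728$ are $2,-1,1/2$.) -}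

module Defs where

open import Level using (0ℓ)
open import Data.Nat as ℕ using (ℕ; zero; suc)
open import Data.Integer as ℤ using (ℤ)
open import Data.List using (List; length; filter; cartesianProduct)
open import Data.List.Membership.Propositional using (_∈_)
open import Data.List.Relation.Unary.Unique.Propositional using (Unique)
open import Data.Product using (_×_; _,_; Σ; ∃)
open import Relation.Binary.PropositionalEquality using (_≡_; _≢_)
open import Relation.Binary.Definitions using (DecidableEquality)
open import Algebra.Structures using (IsCommutativeRing)
import Relation.Nullary

-- A finite field, with propositional equality as its equality.
-- The inverse is total, with the usual requirement x * x⁻¹ = 1 for x ≠ 0
-- (its value at 0 is irrelevant and never used below at 0).
record FiniteField : Set₁ where
  infixl 6 _+_ _-_
  infixl 7 _*_
  infix  8 -_
  field
    Carrier : Set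
    _+_ _*_ : Carrier → Carrier → Carrier
    -_      : Carrier → Carrier
    0# 1#   : Carrier
    isCommutativeRing : IsCommutativeRing _≡_ _+_ _*_ -_ 0# 1#
    0≢1     : 0# ≢ 1#
    _⁻¹     : Carrier → Carrier
    ⁻¹-inverse : ∀ x → x ≢ 0# → x * (x ⁻¹) ≡ 1#
    _≟_     : DecidableEquality Carrier
    elements : List Carrier
    elements-unique   : Unique elements
    elements-complete : ∀ x → x ∈ elements

  _-_ : Carrier → Carrier → Carrier
  x - y = x + (- y)

  size : ℕ
  size = length elements

  fromℕ : ℕ → Carrier
  fromℕ zero    = 0#
  fromℕ (suc n) = 1# + fromℕ n

  2# : Carrier
  2# = 1# + 1#

  half : Carrier
  half = 2# ⁻¹

  cube : Carrier → Carrier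
  cube x = x * x * x

  jLeg : Carrier → Carrier
  jLeg l = fromℕ 256 * cube (l * l - l + 1#)
           * ((l * l * ((l - 1#) * (l - 1#))) ⁻¹)

  onLeg : Carrier → Carrier × Carrier → Set
  onLeg l (x , y) = y * y ≡ x * (x - 1#) * (x - l)

  onLeg? : ∀ l (P : Carrier × Carrier) → Relation.Nullary.Dec (onLeg l P)
  onLeg? l (x , y) = (y * y) ≟ (x * (x - 1#) * (x - l))

  -- |E_λ(F_q)| : affine solutions plus the point at infinity
  #Leg : Carrier → ℕ
  #Leg l = suc (length (filter (onLeg? l) (cartesianProduct elements elements)))

  aLeg : Carrier → ℤ
  aLeg l = ℤ.+ (suc size) ℤ.- ℤ.+ (#Leg l)

  -- Weierstrass coefficients (a1,a2,a3,a4,a6) of the Legendre curve: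
  -- y² = x³ - (1+λ) x² + λ x
  -- Isomorphism over F_q of Weierstrass equations: an admissible change of
  -- variables x = u² x' + r, y = u³ y' + s u² x' + t with u ≠ 0
  -- (Silverman, III.1), transforming the coefficients of E_λ into those of E_β.
  IsoLeg : Carrier → Carrier → Set
  IsoLeg l b =
    Σ Carrier λ u → Σ Carrier λ r → Σ Carrier λ s → Σ Carrier λ t →
      (u ≢ 0#)
    × (u * a1' ≡ a1 + 2# * s)
    × (u * u * a2' ≡ a2 - s * a1 + fromℕ 3 * r - s * s)
    × (u * u * u * a3' ≡ a3 + r * a1 + 2# * t)
    × (u * u * u * u * a4' ≡ a4 - s * a3 + 2# * r * a2 - (t + r * s) * a1
                               + fromℕ 3 * r * r - 2# * s * t)
    × (u * u * u * u * u * u * a6' ≡ a6 + r * a4 + r * r * a2 + r * r * r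
                                     - t * a3 - t * t - r * t * a1)
    where
      a1 = 0#
      a2 = - (1# + l)
      a3 = 0#
      a4 = l
      a6 = 0#
      a1' = 0#
      a2' = - (1# + b)
      a3' = 0#
      a4' = b
      a6' = 0#

  InL : Carrier → Carrier → Set
  InL l b = b ≢ 0# × b ≢ 1# × IsoLeg b l

-- Every congruence in the statement makes q odd, so 2 ≠ 0 in F.
--
-- j = 1728 says 256 (λ² − λ + 1)³ = 1728 λ² (λ − 1)², i.e. 64 ((λ + 1)(λ − 2)(2λ − 1))² = 0, so λ ∈ {−1, 2, 1/2}.
-- For each of these an affine involution σ (x ↦ −x, 2 − x, 1 − x) satisfies f(σx) = −f(x) for f = x (x − 1)(x − λ).
-- If q ≡ 3 mod 4, −1 is a nonsquare, so exactly one of c, −c is a square when c ≠ 0; hence the fibres of E over x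
-- and σx carry two points together, and E has q + 1 points.
--
-- Since a₁ = a₃ = 0 and 2 ≠ 0, an isomorphism of Legendre curves is x ↦ u²x + r with r ∈ {0, 1, β}. Comparing
-- coefficients puts β in the orbit {λ, 1/λ, 1 − λ, 1 − 1/λ, λ/(λ − 1), 1/(1 − λ)}, each member with a prescribed u².
-- For λ = 2 and λ = 1/2 the members other than −1, 2 resp. 1/2 need u² ∈ {±2, ±1/2}, so they occur exactly when 2
-- or −2 is a square. By Euler's criterion (Wilson's theorem, and pairing x with a/x) 2 is a square when q ≡ 1 mod 8;
-- when q ≡ 5 mod 8, a square root of ±2 would give a square root of a root i of −1, and i^((q−1)/2) = −1.

module Submission where

open import Algebra.Bundles using (CommutativeRing; RawRing)
open import Algebra.Solver.Ring.AlmostCommutativeRing using (fromCommutativeRing; _-Raw-AlmostCommutative⟶_)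
open import Data.Bool using (true; false)
open import Data.Empty using (⊥-elim)
import Data.Integer as ℤ
import Data.Integer.Properties as ℤ
open import Data.List using (List; []; _∷_; _++_; length; concatMap; filter; map; foldr; cartesianProduct)
open import Data.List.Membership.Propositional using (_∈_)
open import Data.List.Membership.Propositional.Properties using (∈-∃++; ∈-filter⁺; ∈-filter⁻; ∈-map⁺; ∈-map⁻)
open import Data.List.Membership.Propositional.Properties.WithK using (unique∧set⇒bag)
open import Data.List.Properties using (length-++; filter-++; filter-none; map-∘; map-cong)
open import Data.List.Relation.Binary.BagAndSetEquality using (∼bag⇒↭)
open import Data.List.Relation.Binary.Permutation.Propositional using (_↭_; ↭-refl; ↭-sym; ↭-trans; ↭-prep; ↭⇒↭ₛ)
open import Data.List.Relation.Binary.Permutation.Propositional.Properties using (shift; ∈-resp-↭; ↭-length) renaming (map⁺ to ↭-map⁺)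
import Data.List.Relation.Binary.Permutation.Setoid.Properties as ↭ₛ
open import Data.List.Relation.Binary.Permutation.Setoid.Properties using (foldr-commMonoid)
open import Data.List.Relation.Unary.All as All using (_∷_)
open import Data.List.Relation.Unary.AllPairs as AllPairs using (_∷_)
import Data.List.Relation.Unary.Any as Any
open import Data.List.Relation.Unary.Any using (here; there)
open import Data.List.Relation.Unary.Unique.Propositional using (Unique)
import Data.List.Relation.Unary.Unique.Propositional.Properties as Unique
open import Data.Maybe using (Maybe; just; nothing)
open import Data.Nat as ℕ using (ℕ; zero; suc; NonZero)
import Data.Nat.Properties as ℕ
open import Data.Nat.ListAction using (sum)
open import Data.Nat.ListAction.Properties using (sum-↭)
open import Data.Product using (_×_; _,_; ∃; proj₁; proj₂)
open import Data.Sum as Sum using (_⊎_; inj₁; inj₂; [_,_]′)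
open import Function using (_∘_; id; flip; case_of_)
open import Function.Bundles using (_⇔_; mk⇔)
open import Level using (0ℓ)
open import Relation.Binary.PropositionalEquality as ≡ using (_≡_; _≢_; refl; sym; trans; cong; cong₂; subst)
open import Relation.Nullary using (Dec; yes; no; ¬_; ¬?; does; contradiction)
import Relation.Nullary.Decidable as Dec
open import Relation.Unary using (Decidable)

open import Defs

-- Algebra.Solver.Ring with ℤ as coefficient ring, so that numerals are normalised by computation.
module IntegerCoefficients {c ℓ} (R : CommutativeRing c ℓ) where
  open CommutativeRing R renaming (refl to ≈-refl; sym to ≈-sym; trans to ≈-trans)
  open import Algebra.Properties.Ring ring using (-‿involutive; -0#≈0#; -‿+-comm; -‿distribˡ-*; -‿distribʳ-*)
  open import Algebra.Properties.CommutativeSemigroup +-commutativeSemigroup using (interchange)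
  open import Algebra.Properties.Semiring.Mult.TCOptimised semiring using (1+×; ×-homo-+; ×1-homo-*) renaming (_×_ to _×′_)
  open import Relation.Binary.Reasoning.Setoid setoid

  ι : ℤ.ℤ → Carrier
  ι (ℤ.+ n)    = n ×′ 1#
  ι ℤ.-[1+ n ] = - (suc n ×′ 1#)

  ι-suc : ∀ n → ι (ℤ.+ suc n) ≈ 1# + ι (ℤ.+ n)
  ι-suc n = 1+× n 1#

  ι-⊖ : ∀ m n → ι (m ℤ.⊖ n) ≈ m ×′ 1# - n ×′ 1#
  ι-⊖ zero    zero    = ≈-sym (-‿inverseʳ 0#)
  ι-⊖ zero    (suc n) = ≈-sym (+-identityˡ _)
  ι-⊖ (suc m) zero    = ≈-sym (≈-trans (+-congˡ -0#≈0#) (+-identityʳ _))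
  ι-⊖ (suc m) (suc n) = begin
    ι (suc m ℤ.⊖ suc n)                       ≡⟨ ≡.cong ι (ℤ.[1+m]⊖[1+n]≡m⊖n m n) ⟩
    ι (m ℤ.⊖ n)                               ≈⟨ ι-⊖ m n ⟩
    m ×′ 1# - n ×′ 1#                         ≈⟨ +-identityˡ _ ⟨
    0# + (m ×′ 1# - n ×′ 1#)                  ≈⟨ +-congʳ (-‿inverseʳ 1#) ⟨
    (1# - 1#) + (m ×′ 1# - n ×′ 1#)           ≈⟨ interchange _ _ _ _ ⟩
    (1# + m ×′ 1#) + (- 1# - n ×′ 1#)         ≈⟨ +-congˡ (-‿+-comm 1# _) ⟩
    (1# + m ×′ 1#) - (1# + n ×′ 1#)           ≈⟨ +-cong (1+× m 1#) (-‿cong (1+× n 1#)) ⟨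
    suc m ×′ 1# - suc n ×′ 1#                 ∎

  ι-+ : ∀ i j → ι (i ℤ.+ j) ≈ ι i + ι j
  ι-+ (ℤ.+ m)    (ℤ.+ n)    = ×-homo-+ 1# m n
  ι-+ (ℤ.+ m)    ℤ.-[1+ n ] = ι-⊖ m (suc n)
  ι-+ ℤ.-[1+ m ] (ℤ.+ n)    = ≈-trans (ι-⊖ n (suc m)) (+-comm _ _)
  ι-+ ℤ.-[1+ m ] ℤ.-[1+ n ] = begin
    - (suc (suc (m ℕ.+ n)) ×′ 1#)            ≡⟨ ≡.cong (λ k → - (suc k ×′ 1#)) (ℕ.+-suc m n) ⟨
    - ((suc m ℕ.+ suc n) ×′ 1#)              ≈⟨ -‿cong (×-homo-+ 1# (suc m) (suc n)) ⟩
    - (suc m ×′ 1# + suc n ×′ 1#)             ≈⟨ -‿+-comm _ _ ⟨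
    - (suc m ×′ 1#) - suc n ×′ 1#             ∎

  ι-neg : ∀ i → ι (ℤ.- i) ≈ - ι i
  ι-neg (ℤ.+ zero)  = ≈-sym -0#≈0#
  ι-neg (ℤ.+ suc n) = ≈-refl
  ι-neg ℤ.-[1+ n ]  = ≈-sym (-‿involutive _)

  ι-*⁺ : ∀ m j → ι (ℤ.+ m ℤ.* j) ≈ ι (ℤ.+ m) * ι j
  ι-*⁺ m (ℤ.+ n) = ≈-trans (reflexive (≡.cong ι (≡.sym (ℤ.pos-* m n)))) (×1-homo-* m n)
  ι-*⁺ m ℤ.-[1+ n ] = begin
    ι (ℤ.+ m ℤ.* ℤ.-[1+ n ])                    ≡⟨ ≡.cong ι (ℤ.neg-distribʳ-* (ℤ.+ m) (ℤ.+ suc n)) ⟨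
    ι (ℤ.- (ℤ.+ m ℤ.* ℤ.+ suc n))               ≈⟨ ι-neg (ℤ.+ m ℤ.* ℤ.+ suc n) ⟩
    - ι (ℤ.+ m ℤ.* ℤ.+ suc n)                   ≈⟨ -‿cong (ι-*⁺ m (ℤ.+ suc n)) ⟩
    - (ι (ℤ.+ m) * ι (ℤ.+ suc n))               ≈⟨ -‿distribʳ-* _ _ ⟩
    ι (ℤ.+ m) * ι ℤ.-[1+ n ]                    ∎

  ι-* : ∀ i j → ι (i ℤ.* j) ≈ ι i * ι j
  ι-* (ℤ.+ m)    j = ι-*⁺ m j
  ι-* ℤ.-[1+ m ] j = begin
    ι (ℤ.-[1+ m ] ℤ.* j)                      ≡⟨ ≡.cong ι (ℤ.neg-distribˡ-* (ℤ.+ suc m) j) ⟨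
    ι (ℤ.- (ℤ.+ suc m ℤ.* j))                 ≈⟨ ι-neg (ℤ.+ suc m ℤ.* j) ⟩
    - ι (ℤ.+ suc m ℤ.* j)                     ≈⟨ -‿cong (ι-*⁺ (suc m) j) ⟩
    - (ι (ℤ.+ suc m) * ι j)                   ≈⟨ -‿distribˡ-* _ _ ⟩
    ι ℤ.-[1+ m ] * ι j                        ∎

  ℤ-rawRing : RawRing _ _
  ℤ-rawRing = ℤ.+-*-rawRing

  ι-homomorphism : ℤ-rawRing -Raw-AlmostCommutative⟶ fromCommutativeRing R
  ι-homomorphism = record
    { ⟦_⟧ = ι ; +-homo = ι-+ ; *-homo = ι-* ; -‿homo = ι-neg ; 0-homo = ≈-refl ; 1-homo = ≈-refl }

  ι-≟ : ∀ i j → Maybe (ι i ≈ ι j)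
  ι-≟ i j with i ℤ.≟ j
  ... | yes i≡j = just (reflexive (≡.cong ι i≡j))
  ... | no _    = nothing

  open import Algebra.Solver.Ring ℤ-rawRing (fromCommutativeRing R) ι-homomorphism ι-≟ public

module _ {a} {A : Set a} where

  unique∧set⇒↭ : {xs ys : List A} → Unique xs → Unique ys → (∀ {z} → z ∈ xs ⇔ z ∈ ys) → xs ↭ ys
  unique∧set⇒↭ ux uy xs≈ys = ∼bag⇒↭ (unique∧set⇒bag ux uy xs≈ys)

  Unique-resp-↭ : {xs ys : List A} → xs ↭ ys → Unique xs → Unique ys
  Unique-resp-↭ p = ↭ₛ.Unique-resp-↭ (≡.setoid A) (↭⇒↭ₛ p)

  ∈⇒↭∷ : ∀ {x : A} {xs} → x ∈ xs → ∃ λ ys → xs ↭ x ∷ ys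
  ∈⇒↭∷ x∈xs with us , vs , refl ← ∈-∃++ x∈xs = us ++ vs , shift _ us vs

  ∈-tail : ∀ {x y : A} {xs} → y ∈ x ∷ xs → y ≢ x → y ∈ xs
  ∈-tail (here y≡x) y≢x = contradiction y≡x y≢x
  ∈-tail (there y∈xs) _ = y∈xs

  record IsFreeInvolutionOn (σ : A → A) (xs : List A) : Set a where
    field
      closed           : ∀ {x} → x ∈ xs → σ x ∈ xs
      involutive       : ∀ {x} → x ∈ xs → σ (σ x) ≡ x
      fixed-point-free : ∀ {x} → x ∈ xs → σ x ≢ x

  pairs : (A → A) → List A → List A
  pairs σ = concatMap (λ x → x ∷ σ x ∷ [])

  length-pairs : ∀ σ ys → length (pairs σ ys) ≡ 2 ℕ.* length ys
  length-pairs σ []       = refl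
  length-pairs σ (y ∷ ys) = trans (cong (2 ℕ.+_) (length-pairs σ ys)) (sym (ℕ.*-suc 2 (length ys)))

  ∈-pairs : ∀ {σ y ys} → y ∈ ys → y ∈ pairs σ ys
  ∈-pairs (here refl) = here refl
  ∈-pairs (there y∈)  = there (there (∈-pairs y∈))

  private
    open IsFreeInvolutionOn

    partner∈ : ∀ {σ x xs} → IsFreeInvolutionOn σ (x ∷ xs) → σ x ∈ xs
    partner∈ inv with closed inv (here refl)
    ... | here σx≡x  = contradiction σx≡x (fixed-point-free inv (here refl))
    ... | there σx∈xs = σx∈xs

    split-pair : ∀ {σ x xs} → Unique (x ∷ xs) → IsFreeInvolutionOn σ (x ∷ xs) →
                 ∃ λ rest → x ∷ xs ↭ x ∷ σ x ∷ rest × Unique rest × IsFreeInvolutionOn σ rest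
    split-pair {σ} {x} {xs} u inv with rest , xs↭ ← ∈⇒↭∷ (partner∈ inv) =
      rest , ↭-prep x xs↭ , u′ , record
        { closed           = σ-closed
        ; involutive       = involutive inv ∘ from-rest
        ; fixed-point-free = fixed-point-free inv ∘ from-rest }
      where
      u-pair : Unique (x ∷ σ x ∷ rest)
      u-pair = Unique-resp-↭ (↭-prep x xs↭) u
      x∉rest : All.All (x ≢_) rest
      x∉rest with (_ ∷ x∉) ∷ _ ← u-pair = x∉
      σx∉rest : All.All (σ x ≢_) rest
      σx∉rest with _ ∷ σx∉ ∷ _ ← u-pair = σx∉
      u′ : Unique rest
      u′ with _ ∷ _ ∷ u′ ← u-pair = u′
      from-rest : ∀ {y} → y ∈ rest → y ∈ x ∷ xs
      from-rest y∈ = ∈-resp-↭ (↭-sym (↭-prep x xs↭)) (there (there y∈))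
      -- σ y ∈ x ∷ σ x ∷ rest, but σ y = x would give y = σ x and σ y = σ x would give y = x.
      σ-closed : ∀ {y} → y ∈ rest → σ y ∈ rest
      σ-closed {y} y∈ with ∈-resp-↭ (↭-prep x xs↭) (closed inv (from-rest y∈))
      ... | here σy≡x = contradiction
              (trans (sym (cong σ σy≡x)) (involutive inv (from-rest y∈))) (All.lookup σx∉rest y∈)
      ... | there (here σy≡σx) = contradiction
              (trans (sym (involutive inv (here refl))) (trans (sym (cong σ σy≡σx)) (involutive inv (from-rest y∈))))
              (All.lookup x∉rest y∈)
      ... | there (there σy∈) = σy∈

  ↭-pairs : ∀ {σ xs} → Unique xs → IsFreeInvolutionOn σ xs → ∃ λ ys → xs ↭ pairs σ ys
  ↭-pairs {σ} {xs} = go (length xs) ℕ.≤-refl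
    where
    go : ∀ n {xs} → length xs ℕ.≤ n → Unique xs → IsFreeInvolutionOn σ xs → ∃ λ ys → xs ↭ pairs σ ys
    go _       {[]}     _   _ _ = [] , ↭-refl
    go (suc n) {x ∷ xs} len u inv with rest , x∷xs↭ , u′ , inv′ ← split-pair u inv
      with ys , rest↭ ← go n (ℕ.<⇒≤ (ℕ.≤-pred (ℕ.≤-trans (ℕ.≤-reflexive (sym (↭-length x∷xs↭))) len))) u′ inv′
      = x ∷ ys , ↭-trans x∷xs↭ (↭-prep x (↭-prep (σ x) rest↭))

  sum-map-+ : ∀ (f g : A → ℕ) xs → sum (map (λ x → f x ℕ.+ g x) xs) ≡ sum (map f xs) ℕ.+ sum (map g xs)
  sum-map-+ f g []       = refl
  sum-map-+ f g (x ∷ xs) = trans (cong (f x ℕ.+ g x ℕ.+_) (sum-map-+ f g xs)) (+-interchange (f x) (g x) (sum (map f xs)) (sum (map g xs)))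
    where open import Algebra.Properties.CommutativeSemigroup ℕ.+-commutativeSemigroup
            using () renaming (interchange to +-interchange)

  sum-map-const : ∀ c (xs : List A) → sum (map (λ _ → c) xs) ≡ c ℕ.* length xs
  sum-map-const c []       = sym (ℕ.*-zeroʳ c)
  sum-map-const c (x ∷ xs) = trans (cong (c ℕ.+_) (sum-map-const c xs)) (sym (ℕ.*-suc c (length xs)))

module _ {a b p} {A : Set a} {B : Set b} {P : A × B → Set p} (P? : Decidable P) where

  length-filter-map : ∀ x ys → length (filter P? (map (x ,_) ys)) ≡ length (filter (λ y → P? (x , y)) ys)
  length-filter-map x []       = refl
  length-filter-map x (y ∷ ys) with does (P? (x , y))
  ... | true  = cong suc (length-filter-map x ys)
  ... | false = length-filter-map x ys

  length-filter-cartesianProduct : ∀ xs ys → length (filter P? (cartesianProduct xs ys)) ≡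
                                   sum (map (λ x → length (filter (λ y → P? (x , y)) ys)) xs)
  length-filter-cartesianProduct []       ys = refl
  length-filter-cartesianProduct (x ∷ xs) ys = begin
    length (filter P? (map (x ,_) ys ++ cartesianProduct xs ys))
      ≡⟨ cong length (filter-++ P? (map (x ,_) ys) _) ⟩
    length (filter P? (map (x ,_) ys) ++ filter P? (cartesianProduct xs ys))
      ≡⟨ length-++ (filter P? (map (x ,_) ys)) ⟩
    length (filter P? (map (x ,_) ys)) ℕ.+ length (filter P? (cartesianProduct xs ys))
      ≡⟨ cong₂ ℕ._+_ (length-filter-map x ys) (length-filter-cartesianProduct xs ys) ⟩
    _ ∎
    where open ≡.≡-Reasoning

module FieldTheory (F : FiniteField) where
  open FiniteField F

  commutativeRing : CommutativeRing 0ℓ 0ℓ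
  commutativeRing = record { isCommutativeRing = isCommutativeRing }

  open CommutativeRing commutativeRing
    using (ring; commutativeSemiring; *-isCommutativeMonoid; +-assoc; +-identityˡ; +-identityʳ; *-identityˡ; *-identityʳ;
           *-assoc; *-comm; zeroˡ; zeroʳ; -‿inverseʳ)
  open import Algebra.Properties.Ring ring using (-‿involutive; -0#≈0#; x∙y⁻¹≈ε⇒x≈y; x≈y⇒x∙y⁻¹≈ε)
  open import Algebra.Properties.CommutativeSemiring.Exp commutativeSemiring using (_^_; ^-assocʳ; ^-distrib-*)
  open IntegerCoefficients commutativeRing using (ι; ι-suc; Polynomial; solve; _:=_; _:+_; _:*_; _:-_; :-_; _:^_; con)

  #_ : ∀ {n} → ℕ → Polynomial n
  # k = con (ℤ.+ k)

  x-y≡0⇒x≡y : ∀ {x y} → x - y ≡ 0# → x ≡ y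
  x-y≡0⇒x≡y = x∙y⁻¹≈ε⇒x≈y _ _

  x+y≡0⇒x≡-y : ∀ {x y} → x + y ≡ 0# → x ≡ - y
  x+y≡0⇒x≡-y {x} {y} x+y≡0 = x-y≡0⇒x≡y (trans (cong (x +_) (-‿involutive y)) x+y≡0)

  α*[a-b]≡0 : ∀ α {a b} → a ≡ b → α * (a - b) ≡ 0#
  α*[a-b]≡0 α a≡b = trans (cong (α *_) (x≈y⇒x∙y⁻¹≈ε a≡b)) (zeroʳ α)

  linear-combination : ∀ {x y a b} α → x - y ≡ α * (a - b) → a ≡ b → x ≡ y
  linear-combination α certificate a≡b = x-y≡0⇒x≡y (trans certificate (α*[a-b]≡0 α a≡b))

  linear-combination₂ : ∀ {x y a b c d} α β → x - y ≡ α * (a - b) + β * (c - d) → a ≡ b → c ≡ d → x ≡ y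
  linear-combination₂ α β certificate a≡b c≡d = x-y≡0⇒x≡y (trans certificate
    (trans (cong₂ _+_ (α*[a-b]≡0 α a≡b) (α*[a-b]≡0 β c≡d)) (+-identityˡ 0#)))

  linear-combination₃ : ∀ {x y a b c d e f} α β γ → x - y ≡ α * (a - b) + β * (c - d) + γ * (e - f) →
                        a ≡ b → c ≡ d → e ≡ f → x ≡ y
  linear-combination₃ α β γ certificate a≡b c≡d e≡f = x-y≡0⇒x≡y (trans certificate
    (trans (cong₂ _+_ (trans (cong₂ _+_ (α*[a-b]≡0 α a≡b) (α*[a-b]≡0 β c≡d)) (+-identityˡ 0#)) (α*[a-b]≡0 γ e≡f))
           (+-identityˡ 0#)))

  1≢0 : 1# ≢ 0#
  1≢0 = 0≢1 ∘ sym

  2≢1 : 2# ≢ 1#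
  2≢1 2≡1 = 1≢0 (linear-combination 1# (solve 0 (# 1 :- # 0 := # 1 :* (# 2 :- # 1)) refl) 2≡1)

  x⁻¹*x≡1 : ∀ {x} → x ≢ 0# → x ⁻¹ * x ≡ 1#
  x⁻¹*x≡1 {x} x≢0 = trans (*-comm (x ⁻¹) x) (⁻¹-inverse x x≢0)

  x*y≡0⇒x≡0⊎y≡0 : ∀ {x y} → x * y ≡ 0# → x ≡ 0# ⊎ y ≡ 0#
  x*y≡0⇒x≡0⊎y≡0 {x} {y} xy≡0 with x ≟ 0#
  ... | yes x≡0 = inj₁ x≡0
  ... | no  x≢0 = inj₂ (begin
    y                ≡⟨ *-identityˡ y ⟨
    1# * y           ≡⟨ cong (_* y) (x⁻¹*x≡1 x≢0) ⟨
    x ⁻¹ * x * y     ≡⟨ *-assoc (x ⁻¹) x y ⟩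
    x ⁻¹ * (x * y)   ≡⟨ cong (x ⁻¹ *_) xy≡0 ⟩
    x ⁻¹ * 0#        ≡⟨ zeroʳ (x ⁻¹) ⟩
    0#               ∎)
    where open ≡.≡-Reasoning

  x*x≡0⇒x≡0 : ∀ {x} → x * x ≡ 0# → x ≡ 0#
  x*x≡0⇒x≡0 x²≡0 = [ id , id ]′ (x*y≡0⇒x≡0⊎y≡0 x²≡0)

  *-nonzero : ∀ {x y} → x ≢ 0# → y ≢ 0# → x * y ≢ 0#
  *-nonzero x≢0 y≢0 xy≡0 = [ x≢0 , y≢0 ]′ (x*y≡0⇒x≡0⊎y≡0 xy≡0)

  *-cancelʳ : ∀ {x y z} → z ≢ 0# → x * z ≡ y * z → x ≡ y
  *-cancelʳ {x} {y} {z} z≢0 xz≡yz = [ x-y≡0⇒x≡y , flip contradiction z≢0 ]′ (x*y≡0⇒x≡0⊎y≡0 (linear-combination 1#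
    (solve 3 (λ x y z → (x :- y) :* z :- # 0 := # 1 :* (x :* z :- y :* z)) refl x y z) xz≡yz))

  x*x≡y*y⇒x≡±y : ∀ {x y} → x * x ≡ y * y → x ≡ y ⊎ x ≡ - y
  x*x≡y*y⇒x≡±y {x} {y} x²≡y² = Sum.map x-y≡0⇒x≡y x+y≡0⇒x≡-y (x*y≡0⇒x≡0⊎y≡0 (linear-combination 1#
    (solve 2 (λ x y → (x :- y) :* (x :+ y) :- # 0 := # 1 :* (x :* x :- y :* y)) refl x y) x²≡y²))

  x*x≡1⇒x≡±1 : ∀ {x} → x * x ≡ 1# → x ≡ 1# ⊎ x ≡ - 1#
  x*x≡1⇒x≡±1 x²≡1 = x*x≡y*y⇒x≡±y (trans x²≡1 (sym (*-identityˡ 1#)))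

  x[x-1][x-b]≡0⇒x≡0⊎1⊎b : ∀ {x b} → x * (x - 1#) * (x - b) ≡ 0# → x ≡ 0# ⊎ x ≡ 1# ⊎ x ≡ b
  x[x-1][x-b]≡0⇒x≡0⊎1⊎b x[x-1][x-b]≡0 =
    [ Sum.map₂ (inj₁ ∘ x-y≡0⇒x≡y) ∘ x*y≡0⇒x≡0⊎y≡0 , inj₂ ∘ inj₂ ∘ x-y≡0⇒x≡y ]′
      (x*y≡0⇒x≡0⊎y≡0 x[x-1][x-b]≡0)

  ⁻¹-unique : ∀ {x y} → x * y ≡ 1# → y ≡ x ⁻¹
  ⁻¹-unique {x} {y} xy≡1 = *-cancelʳ x≢0 (trans (*-comm y x) (trans xy≡1 (sym (x⁻¹*x≡1 x≢0))))
    where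
    x≢0 : x ≢ 0#
    x≢0 x≡0 = 0≢1 (trans (sym (zeroˡ y)) (trans (cong (_* y) (sym x≡0)) xy≡1))

  ⁻¹-involutive : ∀ {x} → x ≢ 0# → x ⁻¹ ⁻¹ ≡ x
  ⁻¹-involutive x≢0 = sym (⁻¹-unique (x⁻¹*x≡1 x≢0))

  1⁻¹≡1 : 1# ⁻¹ ≡ 1#
  1⁻¹≡1 = sym (⁻¹-unique (*-identityˡ 1#))

  [-1]⁻¹≡-1 : (- 1#) ⁻¹ ≡ - 1#
  [-1]⁻¹≡-1 = sym (⁻¹-unique (solve 0 (:- # 1 :* :- # 1 := # 1) refl))

  ⁻¹-nonzero : ∀ {x} → x ≢ 0# → x ⁻¹ ≢ 0#
  ⁻¹-nonzero {x} x≢0 x⁻¹≡0 = 0≢1 (trans (sym (zeroʳ x)) (trans (cong (x *_) (sym x⁻¹≡0)) (⁻¹-inverse x x≢0)))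

  -‿nonzero : ∀ {x} → x ≢ 0# → - x ≢ 0#
  -‿nonzero {x} x≢0 -x≡0 = x≢0 (trans (sym (-‿involutive x)) (trans (cong -_ -x≡0) -0#≈0#))

  -1≢0 : - 1# ≢ 0#
  -1≢0 = -‿nonzero 1≢0

  c-[c-x]≡x : ∀ c x → c - (c - x) ≡ x
  c-[c-x]≡x = solve 2 (λ c x → c :- (c :- x) := x) refl

  fromℕ≡ι : ∀ n → fromℕ n ≡ ι (ℤ.+ n)
  fromℕ≡ι zero    = refl
  fromℕ≡ι (suc n) = trans (cong (1# +_) (fromℕ≡ι n)) (sym (ι-suc n))

  -- The value of the solver numeral # 3; ι builds multiples of 1# nested to the left.
  3# : Carrier
  3# = 2# + 1#

  [xyz]²≡x²y²z² : ∀ x y z → x * y * z * (x * y * z) ≡ x * x * (y * y) * (z * z)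
  [xyz]²≡x²y²z² = solve 3 (λ x y z → x :* y :* z :* (x :* y :* z) := x :* x :* (y :* y) :* (z :* z)) refl

  x^2≡x*x : ∀ x → x ^ 2 ≡ x * x
  x^2≡x*x x = cong (x *_) (*-identityʳ x)

  [x*x]^n≡x^[2n] : ∀ x n → (x * x) ^ n ≡ x ^ (2 ℕ.* n)
  [x*x]^n≡x^[2n] x n = trans (cong (_^ n) (sym (x^2≡x*x x))) (^-assocʳ x 2 n)

  1^n≡1 : ∀ n → 1# ^ n ≡ 1#
  1^n≡1 zero    = refl
  1^n≡1 (suc n) = trans (*-identityˡ _) (1^n≡1 n)

  [-1]^[2n]≡1 : ∀ n → (- 1#) ^ (2 ℕ.* n) ≡ 1#
  [-1]^[2n]≡1 n = begin
    (- 1#) ^ (2 ℕ.* n)      ≡⟨ [x*x]^n≡x^[2n] (- 1#) n ⟨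
    (- 1# * - 1#) ^ n       ≡⟨ cong (_^ n) (solve 0 (:- # 1 :* :- # 1 := # 1) refl) ⟩
    1# ^ n                  ≡⟨ 1^n≡1 n ⟩
    1#                      ∎
    where open ≡.≡-Reasoning

  [-1]^[1+2n]≡-1 : ∀ n → (- 1#) ^ suc (2 ℕ.* n) ≡ - 1#
  [-1]^[1+2n]≡-1 n = trans (cong (- 1# *_) ([-1]^[2n]≡1 n)) (*-identityʳ (- 1#))

  i^[2k]≡[-1]^k : ∀ {i} k → i * i ≡ - 1# → i ^ (2 ℕ.* k) ≡ (- 1#) ^ k
  i^[2k]≡[-1]^k {i} k i²≡-1 = trans (sym ([x*x]^n≡x^[2n] i k)) (cong (_^ k) i²≡-1)

  ^-nonzero : ∀ {x} n → x ≢ 0# → x ^ n ≢ 0#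
  ^-nonzero zero    _   = 1≢0
  ^-nonzero (suc n) x≢0 = *-nonzero x≢0 (^-nonzero n x≢0)

  IsSquare : Carrier → Set
  IsSquare a = ∃ λ x → x * x ≡ a

  IsSquare? : ∀ a → Dec (IsSquare a)
  IsSquare? a = Dec.map′ Any.satisfied (λ (x , x²≡a) → Any.map (λ { refl → x²≡a }) (elements-complete x))
                  (Any.any? (λ x → (x * x) ≟ a) elements)

  √i⇒√2 : ∀ {i z} → i * i ≡ - 1# → z * z ≡ i → (z - z * i) * (z - z * i) ≡ 2#
  √i⇒√2 {i} {z} i²≡-1 z²≡i = linear-combination₂ ((1# - i) * (1# - i)) (i - 2#)
    (solve 2 (λ i z → (z :- z :* i) :* (z :- z :* i) :- # 2 := (# 1 :- i) :* (# 1 :- i) :* (z :* z :- i) :+ (i :- # 2) :* (i :* i :- :- # 1)) refl i z)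
    z²≡i i²≡-1

  units : List Carrier
  units = filter (λ x → ¬? (x ≟ 0#)) elements

  #units : ℕ
  #units = length units

  units-unique : Unique units
  units-unique = Unique.filter⁺ (λ x → ¬? (x ≟ 0#)) elements-unique

  ∈-units : ∀ {x} → x ≢ 0# → x ∈ units
  ∈-units x≢0 = ∈-filter⁺ (λ x → ¬? (x ≟ 0#)) (elements-complete _) x≢0

  units-nonzero : ∀ {x} → x ∈ units → x ≢ 0#
  units-nonzero x∈ = proj₂ (∈-filter⁻ (λ x → ¬? (x ≟ 0#)) {xs = elements} x∈)

  elements↭0∷units : elements ↭ 0# ∷ units
  elements↭0∷units = unique∧set⇒↭ elements-unique (All.tabulate (λ x∈ 0≡x → units-nonzero x∈ (sym 0≡x)) ∷ units-unique)
    (λ {x} → mk⇔ (λ _ → case x ≟ 0# of λ where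
                            (yes x≡0) → here x≡0
                            (no x≢0)  → there (∈-units x≢0))
                 (λ _ → elements-complete x))

  size≡1+#units : size ≡ suc #units
  size≡1+#units = ↭-length elements↭0∷units

  +1-freeInvolution : 2# ≡ 0# → IsFreeInvolutionOn (_+ 1#) elements
  +1-freeInvolution 2≡0 = record
    { closed           = λ _ → elements-complete _
    ; involutive       = λ {x} _ → trans (+-assoc x 1# 1#) (trans (cong (x +_) 2≡0) (+-identityʳ x))
    ; fixed-point-free = λ {x} _ x+1≡x → 1≢0 (linear-combination 1#
        (solve 1 (λ x → # 1 :- # 0 := # 1 :* (x :+ # 1 :- x)) refl x) x+1≡x)
    }

  Π : List Carrier → Carrier
  Π = foldr _*_ 1#

  Π-↭ : ∀ {xs ys} → xs ↭ ys → Π xs ≡ Π ys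
  Π-↭ xs↭ys = foldr-commMonoid (≡.setoid Carrier) *-isCommutativeMonoid (↭⇒↭ₛ xs↭ys)

  Π-nonzero : ∀ xs → (∀ {x} → x ∈ xs → x ≢ 0#) → Π xs ≢ 0#
  Π-nonzero []       _       = 1≢0
  Π-nonzero (x ∷ xs) nonzero = *-nonzero (nonzero (here refl)) (Π-nonzero xs (nonzero ∘ there))

  Π-map-* : ∀ a xs → Π (map (a *_) xs) ≡ a ^ length xs * Π xs
  Π-map-* a []       = sym (*-identityˡ 1#)
  Π-map-* a (x ∷ xs) = trans (cong (a * x *_) (Π-map-* a xs))
    (solve 4 (λ a x aⁿ p → a :* x :* (aⁿ :* p) := a :* aⁿ :* (x :* p)) refl a x (a ^ length xs) (Π xs))

  Π-pairs : ∀ {σ a} ys → (∀ {y} → y ∈ ys → y * σ y ≡ a) → Π (pairs σ ys) ≡ a ^ length ys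
  Π-pairs []       _       = refl
  Π-pairs {σ} (y ∷ ys) product = trans (sym (*-assoc y (σ y) _))
    (cong₂ _*_ (product (here refl)) (Π-pairs ys (product ∘ there)))

  fermat : ∀ {a} → a ≢ 0# → a ^ #units ≡ 1#
  fermat {a} a≢0 = *-cancelʳ (Π-nonzero units units-nonzero) (begin
    a ^ #units * Π units   ≡⟨ Π-map-* a units ⟨
    Π (map (a *_) units)   ≡⟨ Π-↭ a*units↭units ⟩
    Π units                ≡⟨ *-identityˡ (Π units) ⟨
    1# * Π units           ∎)
    where
    open ≡.≡-Reasoning
    a*-injective : ∀ {x y} → a * x ≡ a * y → x ≡ y
    a*-injective {x} {y} ax≡ay = *-cancelʳ a≢0 (trans (*-comm x a) (trans ax≡ay (*-comm a y)))
    a*[a⁻¹*z]≡z : ∀ z → a * (a ⁻¹ * z) ≡ z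
    a*[a⁻¹*z]≡z z = trans (sym (*-assoc a (a ⁻¹) z)) (trans (cong (_* z) (⁻¹-inverse a a≢0)) (*-identityˡ z))
    a*units↭units : map (a *_) units ↭ units
    a*units↭units = unique∧set⇒↭ (Unique.map⁺ a*-injective units-unique) units-unique (λ {z} → mk⇔
      (λ z∈ → case ∈-map⁻ (a *_) z∈ of λ where
         (x , x∈ , refl) → ∈-units (*-nonzero a≢0 (units-nonzero x∈)))
      (λ z∈ → subst (_∈ map (a *_) units) (a*[a⁻¹*z]≡z z)
                (∈-map⁺ (a *_) (∈-units (*-nonzero (⁻¹-nonzero a≢0) (units-nonzero z∈))))))

  sqrts : Carrier → List Carrier
  sqrts c = filter (λ y → (y * y) ≟ c) elements

  #sqrts : Carrier → ℕ
  #sqrts c = length (sqrts c)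

  sqrts-unique : ∀ c → Unique (sqrts c)
  sqrts-unique c = Unique.filter⁺ (λ y → (y * y) ≟ c) elements-unique

  ∈-sqrts : ∀ {c y} → y * y ≡ c → y ∈ sqrts c
  ∈-sqrts {c} y²≡c = ∈-filter⁺ (λ y → (y * y) ≟ c) (elements-complete _) y²≡c

  ∈-sqrts⁻ : ∀ {c y} → y ∈ sqrts c → y * y ≡ c
  ∈-sqrts⁻ {c} y∈ = proj₂ (∈-filter⁻ (λ y → (y * y) ≟ c) {xs = elements} y∈)

  sqrts-nonsquare : ∀ {c} → ¬ IsSquare c → sqrts c ≡ []
  sqrts-nonsquare {c} ¬square = filter-none (λ y → (y * y) ≟ c) (All.universal (λ y y²≡c → ¬square (y , y²≡c)) elements)

  sqrts-0 : sqrts 0# ↭ 0# ∷ []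
  sqrts-0 = unique∧set⇒↭ (sqrts-unique 0#) (All.[] ∷ AllPairs.[])
    (mk⇔ (here ∘ x*x≡0⇒x≡0 ∘ ∈-sqrts⁻) λ { (here refl) → ∈-sqrts (zeroˡ 0#) })

  legendre : Carrier → Carrier → Carrier
  legendre l x = x * (x - 1#) * (x - l)

  legendre[-1]-twist : ∀ x → legendre (- 1#) (- x) ≡ - legendre (- 1#) x
  legendre[-1]-twist = solve 1 (λ x → :- x :* (:- x :- # 1) :* (:- x :- :- # 1) := :- (x :* (x :- # 1) :* (x :- :- # 1))) refl

  legendre[2]-twist : ∀ x → legendre 2# (2# - x) ≡ - legendre 2# x
  legendre[2]-twist = solve 1 (λ x → (# 2 :- x) :* (# 2 :- x :- # 1) :* (# 2 :- x :- # 2) := :- (x :* (x :- # 1) :* (x :- # 2))) refl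

  #affine : Carrier → ℕ
  #affine l = length (filter (onLeg? l) (cartesianProduct elements elements))

  aLeg≡0 : ∀ {l} → #affine l ≡ size → aLeg l ≡ ℤ.0ℤ
  aLeg≡0 {l} #affine≡size = trans (cong (λ n → ℤ.+ suc size ℤ.- ℤ.+ suc n) #affine≡size) (ℤ.+-inverseʳ (ℤ.+ suc size))

  sum-map-involution : ∀ (g : Carrier → ℕ) {σ} → (∀ x → σ (σ x) ≡ x) → sum (map (g ∘ σ) elements) ≡ sum (map g elements)
  sum-map-involution g {σ} σσ≡id = trans (cong sum (map-∘ elements)) (sum-↭ (↭-map⁺ g σ[elements]↭elements))
    where
    σ-injective : ∀ {x y} → σ x ≡ σ y → x ≡ y
    σ-injective {x} {y} σx≡σy = trans (sym (σσ≡id x)) (trans (cong σ σx≡σy) (σσ≡id y))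
    σ[elements]↭elements : map σ elements ↭ elements
    σ[elements]↭elements = unique∧set⇒↭ (Unique.map⁺ σ-injective elements-unique) elements-unique
      (λ {x} → mk⇔ (λ _ → elements-complete x) (λ _ → subst (_∈ map σ elements) (σσ≡id x) (∈-map⁺ σ (elements-complete (σ x)))))

  #affine≡size : ∀ {l σ} → (∀ c → #sqrts c ℕ.+ #sqrts (- c) ≡ 2) → (∀ x → σ (σ x) ≡ x) →
                 (∀ x → legendre l (σ x) ≡ - legendre l x) → #affine l ≡ size
  #affine≡size {l} {σ} pair-count σσ≡id twist = ℕ.*-cancelˡ-≡ (#affine l) size 2 (begin
    2 ℕ.* #affine l                               ≡⟨ cong (2 ℕ.*_) (length-filter-cartesianProduct (onLeg? l) elements elements) ⟩
    2 ℕ.* S                                       ≡⟨ cong (S ℕ.+_) (ℕ.+-identityʳ S) ⟩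
    S ℕ.+ S                                       ≡⟨ cong (S ℕ.+_) (sum-map-involution G σσ≡id) ⟨
    S ℕ.+ sum (map (G ∘ σ) elements)              ≡⟨ sum-map-+ G (G ∘ σ) elements ⟨
    sum (map (λ x → G x ℕ.+ G (σ x)) elements)    ≡⟨ cong sum (map-cong fibre-pair elements) ⟩
    sum (map (λ _ → 2) elements)                  ≡⟨ sum-map-const 2 elements ⟩
    2 ℕ.* size                                    ∎)
    where
    open ≡.≡-Reasoning
    G : Carrier → ℕ
    G x = #sqrts (legendre l x)
    S : ℕ
    S = sum (map G elements)
    fibre-pair : ∀ x → G x ℕ.+ G (σ x) ≡ 2
    fibre-pair x = trans (cong (λ c → G x ℕ.+ #sqrts c) (twist x)) (pair-count (legendre l x))

  A₂ A₄ : (v b l r : Carrier) → Set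
  A₂ v b l r = v * (- (1# + l)) ≡ - (1# + b) + 3# * r
  A₄ v b l r = v * v * l ≡ b - 2# * r * (1# + b) + 3# * r * r

  A₂ᵖ A₄ᵖ : ∀ {n} → Polynomial n → Polynomial n → Polynomial n → Polynomial n → Polynomial n
  A₂ᵖ v b l r = v :* (:- (# 1 :+ l)) :- (:- (# 1 :+ b) :+ # 3 :* r)
  A₄ᵖ v b l r = v :* v :* l :- (b :- # 2 :* r :* (# 1 :+ b) :+ # 3 :* r :* r)

  record SimpleIso (b l : Carrier) : Set where
    field
      u r    : Carrier
      u≢0    : u ≢ 0#
      r-root : r * (r - 1#) * (r - b) ≡ 0#
      a₂-eq  : A₂ (u * u) b l r
      a₄-eq  : A₄ (u * u) b l r

  -- The coefficient equations of IsoLeg for s = t = 0, brought to the form of SimpleIso.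
  a₂-rhs : ∀ b r → - (1# + b) - 0# * 0# + fromℕ 3 * r - 0# * 0# ≡ - (1# + b) + 3# * r
  a₂-rhs b r = trans (cong (λ k → - (1# + b) - 0# * 0# + k * r - 0# * 0#) (fromℕ≡ι 3))
    (solve 2 (λ b r → :- (# 1 :+ b) :- # 0 :* # 0 :+ # 3 :* r :- # 0 :* # 0 := :- (# 1 :+ b) :+ # 3 :* r) refl b r)

  a₄-lhs : ∀ u l → u * u * u * u * l ≡ u * u * (u * u) * l
  a₄-lhs = solve 2 (λ u l → u :* u :* u :* u :* l := u :* u :* (u :* u) :* l) refl

  a₄-rhs : ∀ b r → b - 0# * 0# + 2# * r * (- (1# + b)) - (0# + r * 0#) * 0# + fromℕ 3 * r * r - 2# * 0# * 0#
                   ≡ b - 2# * r * (1# + b) + 3# * r * r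
  a₄-rhs b r = trans (cong (λ k → b - 0# * 0# + 2# * r * (- (1# + b)) - (0# + r * 0#) * 0# + k * r * r - 2# * 0# * 0#) (fromℕ≡ι 3))
    (solve 2 (λ b r → b :- # 0 :* # 0 :+ # 2 :* r :* (:- (# 1 :+ b)) :- (# 0 :+ r :* # 0) :* # 0 :+ # 3 :* r :* r :- # 2 :* # 0 :* # 0
                       := b :- # 2 :* r :* (# 1 :+ b) :+ # 3 :* r :* r) refl b r)

  a₆-rhs : ∀ b r → 0# + r * b + r * r * (- (1# + b)) + r * r * r - 0# * 0# - 0# * 0# - r * 0# * 0# ≡ r * (r - 1#) * (r - b)
  a₆-rhs = solve 2 (λ b r → # 0 :+ r :* b :+ r :* r :* (:- (# 1 :+ b)) :+ r :* r :* r :- # 0 :* # 0 :- # 0 :* # 0 :- r :* # 0 :* # 0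
                             := r :* (r :- # 1) :* (r :- b)) refl

  SimpleIso⇒IsoLeg : ∀ {b l} → SimpleIso b l → IsoLeg b l
  SimpleIso⇒IsoLeg {b} {l} record { u = u ; r = r ; u≢0 = u≢0 ; r-root = r-root ; a₂-eq = a₂-eq ; a₄-eq = a₄-eq } =
    u , r , 0# , 0# , u≢0 ,
    solve 1 (λ u → u :* # 0 := # 0 :+ # 2 :* # 0) refl u ,
    trans a₂-eq (sym (a₂-rhs b r)) ,
    solve 2 (λ u r → u :* u :* u :* # 0 := # 0 :+ r :* # 0 :+ # 2 :* # 0) refl u r ,
    trans (a₄-lhs u l) (trans a₄-eq (sym (a₄-rhs b r))) ,
    trans (zeroʳ _) (trans (sym r-root) (sym (a₆-rhs b r)))

  module OddCharacteristic (2≢0 : 2# ≢ 0#) where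

    1≢-1 : 1# ≢ - 1#
    1≢-1 1≡-1 = 2≢0 (trans (cong (1# +_) 1≡-1) (-‿inverseʳ 1#))

    x≢-x : ∀ {x} → x ≢ 0# → x ≢ - x
    x≢-x {x} x≢0 x≡-x = *-nonzero 2≢0 x≢0
      (linear-combination 1# (solve 1 (λ x → # 2 :* x :- # 0 := # 1 :* (x :- :- x)) refl x) x≡-x)

    2*x≡0⇒x≡0 : ∀ {x} → 2# * x ≡ 0# → x ≡ 0#
    2*x≡0⇒x≡0 2x≡0 = [ flip contradiction 2≢0 , id ]′ (x*y≡0⇒x≡0⊎y≡0 2x≡0)

    2*x≡2*y⇒x≡y : ∀ {x y} → 2# * x ≡ 2# * y → x ≡ y
    2*x≡2*y⇒x≡y {x} {y} 2x≡2y = *-cancelʳ 2≢0 (trans (*-comm x 2#) (trans 2x≡2y (*-comm 2# y)))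

    2*half≡1 : 2# * half ≡ 1#
    2*half≡1 = ⁻¹-inverse 2# 2≢0

    2*x≡1⇒x≡half : ∀ {x} → 2# * x ≡ 1# → x ≡ half
    2*x≡1⇒x≡half = ⁻¹-unique

    half≢0 : half ≢ 0#
    half≢0 = ⁻¹-nonzero 2≢0

    half≢1 : half ≢ 1#
    half≢1 half≡1 = 2≢1 (trans (sym (*-identityʳ 2#)) (trans (cong (2# *_) (sym half≡1)) 2*half≡1))

    √2⇒√i : ∀ {i u} → i * i ≡ - 1# → u * u ≡ 2# → (1# + i) * u * half * ((1# + i) * u * half) ≡ i
    √2⇒√i {i} {u} i²≡-1 u²≡2 = trans ([xyz]²≡x²y²z² (1# + i) u half)
      (linear-combination₃ ((1# + i) * (1# + i) * (half * half)) (2# * (half * half)) (i * (2# * half + 1#))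
        (solve 3 (λ i v h → (# 1 :+ i) :* (# 1 :+ i) :* v :* (h :* h) :- i
                    := (# 1 :+ i) :* (# 1 :+ i) :* (h :* h) :* (v :- # 2) :+ # 2 :* (h :* h) :* (i :* i :- :- # 1)
                       :+ i :* (# 2 :* h :+ # 1) :* (# 2 :* h :- # 1)) refl i (u * u) half)
        u²≡2 i²≡-1 2*half≡1)

    √-2⇒√-i : ∀ {i u} → i * i ≡ - 1# → u * u ≡ - 2# → (1# + i) * u * half * ((1# + i) * u * half) ≡ - i
    √-2⇒√-i {i} {u} i²≡-1 u²≡-2 = trans ([xyz]²≡x²y²z² (1# + i) u half)
      (linear-combination₃ ((1# + i) * (1# + i) * (half * half)) (- 2# * (half * half)) (- i * (2# * half + 1#))
        (solve 3 (λ i v h → (# 1 :+ i) :* (# 1 :+ i) :* v :* (h :* h) :- :- i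
                    := (# 1 :+ i) :* (# 1 :+ i) :* (h :* h) :* (v :- :- # 2) :+ :- # 2 :* (h :* h) :* (i :* i :- :- # 1)
                       :+ :- i :* (# 2 :* h :+ # 1) :* (# 2 :* h :- # 1)) refl i (u * u) half)
        u²≡-2 i²≡-1 2*half≡1)

    sqrts-square : ∀ {w} → w ≢ 0# → sqrts (w * w) ↭ w ∷ - w ∷ []
    sqrts-square {w} w≢0 = unique∧set⇒↭ (sqrts-unique (w * w)) ((x≢-x w≢0 ∷ All.[]) ∷ All.[] ∷ AllPairs.[])
      (mk⇔ (λ y∈ → [ here , there ∘ here ]′ (x*x≡y*y⇒x≡±y (∈-sqrts⁻ y∈)))
           (λ { (here refl) → ∈-sqrts refl
              ; (there (here refl)) → ∈-sqrts (solve 1 (λ w → :- w :* :- w := w :* w) refl w) }))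

    #sqrts-square : ∀ {c} → c ≢ 0# → IsSquare c → #sqrts c ≡ 2
    #sqrts-square c≢0 (w , refl) = ↭-length (sqrts-square (λ w≡0 → c≢0 (trans (cong (_* w) w≡0) (zeroˡ w))))

    legendre[half]-twist : ∀ x → legendre half (1# - x) ≡ - legendre half x
    legendre[half]-twist x = linear-combination (- (x * (x - 1#)))
      (solve 2 (λ x h → (# 1 :- x) :* (# 1 :- x :- # 1) :* (# 1 :- x :- h) :- :- (x :* (x :- # 1) :* (x :- h))
                  := :- (x :* (x :- # 1)) :* (# 2 :* h :- # 1)) refl x half)
      2*half≡1

    jLeg≡1728⇒λ≡-1⊎2⊎half : ∀ {l} → l ≢ 0# → l ≢ 1# → jLeg l ≡ fromℕ 1728 → l ≡ - 1# ⊎ l ≡ 2# ⊎ l ≡ half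
    jLeg≡1728⇒λ≡-1⊎2⊎half {l} l≢0 l≢1 j≡1728 =
      [ Sum.map x+y≡0⇒x≡-y (inj₁ ∘ x-y≡0⇒x≡y) ∘ x*y≡0⇒x≡0⊎y≡0 , inj₂ ∘ inj₂ ∘ 2*x≡1⇒x≡half ∘ x-y≡0⇒x≡y ]′
        (x*y≡0⇒x≡0⊎y≡0 Q≡0)
      where
      C D Q : Carrier
      C = l * l - l + 1#
      D = l * l * ((l - 1#) * (l - 1#))
      Q = (l + 1#) * (l - 2#) * (2# * l - 1#)
      D≢0 : D ≢ 0#
      D≢0 = *-nonzero (*-nonzero l≢0 l≢0) (*-nonzero l-1≢0 l-1≢0)
        where
        l-1≢0 : l - 1# ≢ 0#
        l-1≢0 = l≢1 ∘ x-y≡0⇒x≡y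
      256C³≡1728D : ι (ℤ.+ 256) * cube C ≡ ι (ℤ.+ 1728) * D
      256C³≡1728D = begin
        ι (ℤ.+ 256) * cube C                  ≡⟨ cong (_* cube C) (fromℕ≡ι 256) ⟨
        fromℕ 256 * cube C                    ≡⟨ *-identityʳ _ ⟨
        fromℕ 256 * cube C * 1#               ≡⟨ cong (fromℕ 256 * cube C *_) (x⁻¹*x≡1 D≢0) ⟨
        fromℕ 256 * cube C * (D ⁻¹ * D)       ≡⟨ *-assoc _ (D ⁻¹) D ⟨
        jLeg l * D                            ≡⟨ cong (_* D) (trans j≡1728 (fromℕ≡ι 1728)) ⟩
        ι (ℤ.+ 1728) * D                      ∎
        where open ≡.≡-Reasoning
      64Q²≡0 : ι (ℤ.+ 64) * (Q * Q) ≡ 0#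
      64Q²≡0 = linear-combination 1#
        (solve 1 (λ l → # 64 :* (((l :+ # 1) :* (l :- # 2) :* (# 2 :* l :- # 1)) :* ((l :+ # 1) :* (l :- # 2) :* (# 2 :* l :- # 1))) :- # 0
                     := # 1 :* (# 256 :* ((l :* l :- l :+ # 1) :* (l :* l :- l :+ # 1) :* (l :* l :- l :+ # 1))
                                :- # 1728 :* (l :* l :* ((l :- # 1) :* (l :- # 1))))) refl l)
        256C³≡1728D
      Q≡0 : Q ≡ 0#
      Q≡0 = x*x≡0⇒x≡0 ([ flip contradiction 64≢0 , id ]′ (x*y≡0⇒x≡0⊎y≡0 64Q²≡0))
        where
        64≢0 : ι (ℤ.+ 64) ≢ 0#
        64≢0 = ^-nonzero 6 2≢0 ∘ trans (solve 0 (# 2 :^ 6 := # 64) refl)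

    IsoLeg⇒SimpleIso : ∀ {b l} → IsoLeg b l → SimpleIso b l
    IsoLeg⇒SimpleIso {b} {l} (u , r , s , t , u≢0 , e₁ , e₂ , e₃ , e₄ , e₆)
      with refl ← 2*x≡0⇒x≡0 (trans (sym (+-identityˡ (2# * s))) (trans (sym e₁) (zeroʳ u)))
         | refl ← 2*x≡0⇒x≡0 (trans (solve 2 (λ r t → # 2 :* t := # 0 :+ r :* # 0 :+ # 2 :* t) refl r t) (trans (sym e₃) (zeroʳ _)))
      = record
      { u      = u
      ; r      = r
      ; u≢0    = u≢0
      ; r-root = trans (sym (a₆-rhs b r)) (trans (sym e₆) (zeroʳ _))
      ; a₂-eq  = trans e₂ (a₂-rhs b r)
      ; a₄-eq  = trans (sym (a₄-lhs u l)) (trans e₄ (a₄-rhs b r))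
      }

    -- The six Legendre parameters λ, 1/λ, 1 − λ, 1 − 1/λ, λ/(λ − 1), 1/(1 − λ), cleared of denominators,
    -- each together with the value of v = u² that realises it.
    Orbit : (b l v : Carrier) → Set
    Orbit b l v = (v ≡ 1# × b ≡ l)
                ⊎ (l * v ≡ 1# × l * b ≡ 1#)
                ⊎ (v ≡ - 1# × b ≡ 1# - l)
                ⊎ (l * v ≡ - 1# × l * b ≡ l - 1#)
                ⊎ ((1# - l) * v ≡ 1# × (1# - l) * b ≡ - l)
                ⊎ ((1# - l) * v ≡ - 1# × (1# - l) * b ≡ 1#)

    orbit-r≡0 : ∀ {v b l} → A₂ v b l 0# → A₄ v b l 0# → Orbit b l v
    orbit-r≡0 {v} {b} {l} a₂ a₄ = [ lv≡1 , v≡1 ]′ (x*y≡0⇒x≡0⊎y≡0 (linear-combination₂ 1# 1#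
        (solve 3 (λ v b l → (l :* v :- # 1) :* (v :- # 1) :- # 0 := # 1 :* A₂ᵖ v b l (# 0) :+ # 1 :* A₄ᵖ v b l (# 0)) refl v b l)
        a₂ a₄))
      where
      v≡1 : v - 1# ≡ 0# → Orbit b l v
      v≡1 v-1≡0 = inj₁ (x-y≡0⇒x≡y v-1≡0 , linear-combination₂ 1# (1# + l)
        (solve 3 (λ v b l → b :- l := # 1 :* A₂ᵖ v b l (# 0) :+ (# 1 :+ l) :* (v :- # 1)) refl v b l) a₂ (x-y≡0⇒x≡y v-1≡0))
      lv≡1 : l * v - 1# ≡ 0# → Orbit b l v
      lv≡1 lv-1≡0 = inj₂ (inj₁ (x-y≡0⇒x≡y lv-1≡0 , linear-combination₂ l (1# + l)
        (solve 3 (λ v b l → l :* b :- # 1 := l :* A₂ᵖ v b l (# 0) :+ (# 1 :+ l) :* (l :* v :- # 1)) refl v b l) a₂ (x-y≡0⇒x≡y lv-1≡0)))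

    orbit-r≡1 : ∀ {v b l} → A₂ v b l 1# → A₄ v b l 1# → Orbit b l v
    orbit-r≡1 {v} {b} {l} a₂ a₄ = [ lv≡-1 , v≡-1 ]′ (x*y≡0⇒x≡0⊎y≡0 (linear-combination₂ (- 1#) 1#
        (solve 3 (λ v b l → (l :* v :+ # 1) :* (v :+ # 1) :- # 0 := :- # 1 :* A₂ᵖ v b l (# 1) :+ # 1 :* A₄ᵖ v b l (# 1)) refl v b l)
        a₂ a₄))
      where
      v≡-1 : v + 1# ≡ 0# → Orbit b l v
      v≡-1 v+1≡0 = inj₂ (inj₂ (inj₁ (x+y≡0⇒x≡-y v+1≡0 , linear-combination₂ 1# (1# + l)
        (solve 3 (λ v b l → b :- (# 1 :- l) := # 1 :* A₂ᵖ v b l (# 1) :+ (# 1 :+ l) :* (v :- :- # 1)) refl v b l) a₂ (x+y≡0⇒x≡-y v+1≡0))))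
      lv≡-1 : l * v + 1# ≡ 0# → Orbit b l v
      lv≡-1 lv+1≡0 = inj₂ (inj₂ (inj₂ (inj₁ (x+y≡0⇒x≡-y lv+1≡0 , linear-combination₂ l (1# + l)
        (solve 3 (λ v b l → l :* b :- (l :- # 1) := l :* A₂ᵖ v b l (# 1) :+ (# 1 :+ l) :* (l :* v :- :- # 1)) refl v b l)
        a₂ (x+y≡0⇒x≡-y lv+1≡0)))))

    orbit-r≡b : ∀ {v b l} → A₂ v b l b → A₄ v b l b → Orbit b l v
    orbit-r≡b {v} {b} {l} a₂ a₄ = [ w≡1 , w≡-1 ]′ (x*x≡1⇒x≡±1 (linear-combination₂ (- ((1# + l) * v + 1# - 2# * b)) (- ι (ℤ.+ 4))
        (solve 3 (λ v b l → (# 1 :- l) :* v :* ((# 1 :- l) :* v) :- # 1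
                    := :- ((# 1 :+ l) :* v :+ # 1 :- # 2 :* b) :* A₂ᵖ v b l b :+ :- # 4 :* A₄ᵖ v b l b) refl v b l)
        a₂ a₄))
      where
      w≡1 : (1# - l) * v ≡ 1# → Orbit b l v
      w≡1 w≡1 = inj₂ (inj₂ (inj₂ (inj₂ (inj₁ (w≡1 , 2*x≡2*y⇒x≡y (linear-combination₂ (- (1# - l)) (- (1# + l))
        (solve 3 (λ v b l → # 2 :* ((# 1 :- l) :* b) :- # 2 :* (:- l)
                    := :- (# 1 :- l) :* A₂ᵖ v b l b :+ :- (# 1 :+ l) :* ((# 1 :- l) :* v :- # 1)) refl v b l)
        a₂ w≡1))))))
      w≡-1 : (1# - l) * v ≡ - 1# → Orbit b l v
      w≡-1 w≡-1 = inj₂ (inj₂ (inj₂ (inj₂ (inj₂ (w≡-1 , 2*x≡2*y⇒x≡y (linear-combination₂ (- (1# - l)) (- (1# + l))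
        (solve 3 (λ v b l → # 2 :* ((# 1 :- l) :* b) :- # 2 :* # 1
                    := :- (# 1 :- l) :* A₂ᵖ v b l b :+ :- (# 1 :+ l) :* ((# 1 :- l) :* v :- :- # 1)) refl v b l)
        a₂ w≡-1))))))

    SimpleIso⇒Orbit : ∀ {b l} (iso : SimpleIso b l) → Orbit b l (SimpleIso.u iso * SimpleIso.u iso)
    SimpleIso⇒Orbit record { r-root = r-root ; a₂-eq = a₂-eq ; a₄-eq = a₄-eq } with x[x-1][x-b]≡0⇒x≡0⊎1⊎b r-root
    ... | inj₁ refl        = orbit-r≡0 a₂-eq a₄-eq
    ... | inj₂ (inj₁ refl) = orbit-r≡1 a₂-eq a₄-eq
    ... | inj₂ (inj₂ refl) = orbit-r≡b a₂-eq a₄-eq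

    Orbit[2]⇒ : ∀ {b u} → Orbit b 2# (u * u) → b ≡ - 1# ⊎ b ≡ 2# ⊎ (b ≡ half × (IsSquare 2# ⊎ IsSquare (- 2#)))
    Orbit[2]⇒ (inj₁ (_ , b≡2)) = inj₂ (inj₁ b≡2)
    Orbit[2]⇒ {u = u} (inj₂ (inj₁ (2v≡1 , 2b≡1))) = inj₂ (inj₂ (2*x≡1⇒x≡half 2b≡1 , inj₁ (2# * u , linear-combination 2#
      (solve 1 (λ u → # 2 :* u :* (# 2 :* u) :- # 2 := # 2 :* (# 2 :* (u :* u) :- # 1)) refl u) 2v≡1)))
    Orbit[2]⇒ (inj₂ (inj₂ (inj₁ (_ , b≡1-2)))) = inj₁ (trans b≡1-2 (solve 0 (# 1 :- # 2 := :- # 1) refl))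
    Orbit[2]⇒ {u = u} (inj₂ (inj₂ (inj₂ (inj₁ (2v≡-1 , 2b≡2-1))))) =
      inj₂ (inj₂ (2*x≡1⇒x≡half (trans 2b≡2-1 (solve 0 (# 2 :- # 1 := # 1) refl)) , inj₂ (2# * u , linear-combination 2#
        (solve 1 (λ u → # 2 :* u :* (# 2 :* u) :- :- # 2 := # 2 :* (# 2 :* (u :* u) :- :- # 1)) refl u) 2v≡-1)))
    Orbit[2]⇒ {b} (inj₂ (inj₂ (inj₂ (inj₂ (inj₁ (_ , [1-2]b≡-2)))))) = inj₂ (inj₁ (linear-combination (- 1#)
      (solve 1 (λ b → b :- # 2 := :- # 1 :* ((# 1 :- # 2) :* b :- :- # 2)) refl b) [1-2]b≡-2))
    Orbit[2]⇒ {b} (inj₂ (inj₂ (inj₂ (inj₂ (inj₂ (_ , [1-2]b≡1)))))) = inj₁ (linear-combination (- 1#)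
      (solve 1 (λ b → b :- :- # 1 := :- # 1 :* ((# 1 :- # 2) :* b :- # 1)) refl b) [1-2]b≡1)

    Orbit[half]⇒ : ∀ {b u} → Orbit b half (u * u) → b ≡ half ⊎ IsSquare 2# ⊎ IsSquare (- 2#)
    Orbit[half]⇒ (inj₁ (_ , b≡half)) = inj₁ b≡half
    Orbit[half]⇒ {u = u} (inj₂ (inj₁ (hv≡1 , _))) = inj₂ (inj₁ (u , linear-combination₂ 2# (- (u * u))
      (solve 2 (λ u h → u :* u :- # 2 := # 2 :* (h :* (u :* u) :- # 1) :+ :- (u :* u) :* (# 2 :* h :- # 1)) refl u half) hv≡1 2*half≡1))
    Orbit[half]⇒ {b} (inj₂ (inj₂ (inj₁ (_ , b≡1-half)))) = inj₁ (linear-combination₂ 1# (- 1#)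
      (solve 2 (λ b h → b :- h := # 1 :* (b :- (# 1 :- h)) :+ :- # 1 :* (# 2 :* h :- # 1)) refl b half) b≡1-half 2*half≡1)
    Orbit[half]⇒ {u = u} (inj₂ (inj₂ (inj₂ (inj₁ (hv≡-1 , _))))) = inj₂ (inj₂ (u , linear-combination₂ 2# (- (u * u))
      (solve 2 (λ u h → u :* u :- :- # 2 := # 2 :* (h :* (u :* u) :- :- # 1) :+ :- (u :* u) :* (# 2 :* h :- # 1)) refl u half) hv≡-1 2*half≡1))
    Orbit[half]⇒ {u = u} (inj₂ (inj₂ (inj₂ (inj₂ (inj₁ ([1-h]v≡1 , _)))))) = inj₂ (inj₁ (u , linear-combination₂ 2# (u * u)
      (solve 2 (λ u h → u :* u :- # 2 := # 2 :* ((# 1 :- h) :* (u :* u) :- # 1) :+ u :* u :* (# 2 :* h :- # 1)) refl u half) [1-h]v≡1 2*half≡1))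
    Orbit[half]⇒ {u = u} (inj₂ (inj₂ (inj₂ (inj₂ (inj₂ ([1-h]v≡-1 , _)))))) = inj₂ (inj₂ (u , linear-combination₂ 2# (u * u)
      (solve 2 (λ u h → u :* u :- :- # 2 := # 2 :* ((# 1 :- h) :* (u :* u) :- :- # 1) :+ u :* u :* (# 2 :* h :- # 1)) refl u half) [1-h]v≡-1 2*half≡1))

    InL[2]⇒ : ∀ {b} → InL 2# b → b ≡ - 1# ⊎ b ≡ 2# ⊎ (b ≡ half × (IsSquare 2# ⊎ IsSquare (- 2#)))
    InL[2]⇒ (_ , _ , iso) = Orbit[2]⇒ (SimpleIso⇒Orbit (IsoLeg⇒SimpleIso iso))

    InL[half]⇒ : ∀ {b} → InL half b → b ≡ half ⊎ IsSquare 2# ⊎ IsSquare (- 2#)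
    InL[half]⇒ (_ , _ , iso) = Orbit[half]⇒ (SimpleIso⇒Orbit (IsoLeg⇒SimpleIso iso))

    -1∈L[2] : InL 2# (- 1#)
    -1∈L[2] = -1≢0 , 1≢-1 ∘ sym , SimpleIso⇒IsoLeg (record
      { u      = 1#
      ; r      = - 1#
      ; u≢0    = 1≢0
      ; r-root = solve 0 (:- # 1 :* (:- # 1 :- # 1) :* (:- # 1 :- :- # 1) := # 0) refl
      ; a₂-eq  = solve 0 (# 1 :* # 1 :* (:- (# 1 :+ # 2)) := :- (# 1 :+ :- # 1) :+ # 3 :* :- # 1) refl
      ; a₄-eq  = solve 0 (# 1 :* # 1 :* (# 1 :* # 1) :* # 2 := :- # 1 :- # 2 :* :- # 1 :* (# 1 :+ :- # 1) :+ # 3 :* :- # 1 :* :- # 1) refl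
      })

    l∈L[l] : ∀ {l} → l ≢ 0# → l ≢ 1# → InL l l
    l∈L[l] {l} l≢0 l≢1 = l≢0 , l≢1 , SimpleIso⇒IsoLeg (record
      { u      = 1#
      ; r      = 0#
      ; u≢0    = 1≢0
      ; r-root = solve 1 (λ l → # 0 :* (# 0 :- # 1) :* (# 0 :- l) := # 0) refl l
      ; a₂-eq  = solve 1 (λ l → # 1 :* # 1 :* (:- (# 1 :+ l)) := :- (# 1 :+ l) :+ # 3 :* # 0) refl l
      ; a₄-eq  = solve 1 (λ l → # 1 :* # 1 :* (# 1 :* # 1) :* l := l :- # 2 :* # 0 :* (# 1 :+ l) :+ # 3 :* # 0 :* # 0) refl l
      })

    half∈L[2] : IsSquare 2# → InL 2# half
    half∈L[2] (w , w²≡2) = half≢0 , half≢1 , SimpleIso⇒IsoLeg (record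
      { u      = w * half
      ; r      = 0#
      ; u≢0    = *-nonzero w≢0 half≢0
      ; r-root = solve 1 (λ h → # 0 :* (# 0 :- # 1) :* (# 0 :- h) := # 0) refl half
      ; a₂-eq  = linear-combination₂ (- 3#) (- 1#)
          (solve 2 (λ v h → A₂ᵖ v h (# 2) (# 0) := :- # 3 :* (v :- h) :+ :- # 1 :* (# 2 :* h :- # 1)) refl v half)
          v≡half 2*half≡1
      ; a₄-eq  = linear-combination₂ (2# * (v + half)) half
          (solve 2 (λ v h → A₄ᵖ v h (# 2) (# 0) := # 2 :* (v :+ h) :* (v :- h) :+ h :* (# 2 :* h :- # 1)) refl v half)
          v≡half 2*half≡1
      })
      where
      w≢0 : w ≢ 0#
      w≢0 w≡0 = 2≢0 (trans (sym w²≡2) (trans (cong (_* w) w≡0) (zeroˡ w)))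
      v : Carrier
      v = w * half * (w * half)
      v≡half : v ≡ half
      v≡half = linear-combination₂ (half * half) half
        (solve 2 (λ w h → w :* h :* (w :* h) :- h := h :* h :* (w :* w :- # 2) :+ h :* (# 2 :* h :- # 1)) refl w half)
        w²≡2 2*half≡1

    L[2]-with-√2 : IsSquare 2# → ∀ b → InL 2# b ⇔ (b ≡ - 1# ⊎ b ≡ 2# ⊎ b ≡ half)
    L[2]-with-√2 2∈□ b = mk⇔ (Sum.map₂ (Sum.map₂ proj₁) ∘ InL[2]⇒) λ where
      (inj₁ refl)        → -1∈L[2]
      (inj₂ (inj₁ refl)) → l∈L[l] 2≢0 2≢1
      (inj₂ (inj₂ refl)) → half∈L[2] 2∈□

    L[2]-without-√±2 : ¬ IsSquare 2# → ¬ IsSquare (- 2#) → ∀ b → InL 2# b ⇔ (b ≡ - 1# ⊎ b ≡ 2#)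
    L[2]-without-√±2 2∉□ -2∉□ b = mk⇔ (Sum.map₂ [ id , ⊥-elim ∘ [ 2∉□ , -2∉□ ]′ ∘ proj₂ ]′ ∘ InL[2]⇒) λ where
      (inj₁ refl) → -1∈L[2]
      (inj₂ refl) → l∈L[l] 2≢0 2≢1

    L[half]-without-√±2 : ¬ IsSquare 2# → ¬ IsSquare (- 2#) → ∀ b → InL half b ⇔ b ≡ half
    L[half]-without-√±2 2∉□ -2∉□ b = mk⇔ ([ id , ⊥-elim ∘ [ 2∉□ , -2∉□ ]′ ]′ ∘ InL[half]⇒) λ where
      refl → l∈L[l] half≢0 half≢1

  module OddOrder (h : ℕ) (#units≡2h : #units ≡ 2 ℕ.* h) where

    2≢0 : 2# ≢ 0#
    2≢0 2≡0 with ys , elements↭ ← ↭-pairs elements-unique (+1-freeInvolution 2≡0) =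
      ℕ.even≢odd (length ys) h (begin
        2 ℕ.* length ys             ≡⟨ length-pairs (_+ 1#) ys ⟨
        length (pairs (_+ 1#) ys)   ≡⟨ ↭-length elements↭ ⟨
        size                        ≡⟨ size≡1+#units ⟩
        suc #units                  ≡⟨ cong suc #units≡2h ⟩
        suc (2 ℕ.* h)               ∎)
      where open ≡.≡-Reasoning

    open OddCharacteristic 2≢0 public

    units↭1∷-1∷rest : ∃ λ rest → units ↭ 1# ∷ - 1# ∷ rest
    units↭1∷-1∷rest
      with us , units↭1∷us ← ∈⇒↭∷ (∈-units 1≢0)
      with rest , us↭-1∷rest ← ∈⇒↭∷ (∈-tail (∈-resp-↭ units↭1∷us (∈-units -1≢0)) (1≢-1 ∘ sym))
      = rest , ↭-trans units↭1∷us (↭-prep 1# us↭-1∷rest)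

    module _ {rest} (units↭ : units ↭ 1# ∷ - 1# ∷ rest) where

      private
        unique : Unique (1# ∷ - 1# ∷ rest)
        unique = Unique-resp-↭ units↭ units-unique

      rest-unique : Unique rest
      rest-unique with _ ∷ _ ∷ u ← unique = u

      rest-nonzero : ∀ {y} → y ∈ rest → y ≢ 0#
      rest-nonzero y∈ = units-nonzero (∈-resp-↭ (↭-sym units↭) (there (there y∈)))

      rest-≢±1 : ∀ {y} → y ∈ rest → y ≢ 1# × y ≢ - 1#
      rest-≢±1 y∈ with (_ ∷ 1∉) ∷ -1∉ ∷ _ ← unique =
        (λ y≡1 → All.lookup 1∉ y∈ (sym y≡1)) , (λ y≡-1 → All.lookup -1∉ y∈ (sym y≡-1))

      ⁻¹-freeInvolution : IsFreeInvolutionOn _⁻¹ rest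
      ⁻¹-freeInvolution = record
        { closed           = closed
        ; involutive       = ⁻¹-involutive ∘ rest-nonzero
        ; fixed-point-free = λ y∈ y⁻¹≡y → [ proj₁ (rest-≢±1 y∈) , proj₂ (rest-≢±1 y∈) ]′
            (x*x≡1⇒x≡±1 (trans (cong (_ *_) (sym y⁻¹≡y)) (⁻¹-inverse _ (rest-nonzero y∈))))
        }
        where
        ⁻¹-swap : ∀ {y c} → y ∈ rest → y ⁻¹ ≡ c → y ≡ c ⁻¹
        ⁻¹-swap y∈ y⁻¹≡c = trans (sym (⁻¹-involutive (rest-nonzero y∈))) (cong _⁻¹ y⁻¹≡c)
        closed : ∀ {y} → y ∈ rest → y ⁻¹ ∈ rest
        closed {y} y∈ with ∈-resp-↭ units↭ (∈-units (⁻¹-nonzero (rest-nonzero y∈)))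
        ... | here y⁻¹≡1          = ⊥-elim (proj₁ (rest-≢±1 y∈) (trans (⁻¹-swap y∈ y⁻¹≡1) 1⁻¹≡1))
        ... | there (here y⁻¹≡-1) = ⊥-elim (proj₂ (rest-≢±1 y∈) (trans (⁻¹-swap y∈ y⁻¹≡-1) [-1]⁻¹≡-1))
        ... | there (there y⁻¹∈)  = y⁻¹∈

    wilson : Π units ≡ - 1#
    wilson with rest , units↭ ← units↭1∷-1∷rest
      with ys , rest↭ ← ↭-pairs (rest-unique units↭) (⁻¹-freeInvolution units↭) = begin
        Π units                     ≡⟨ Π-↭ units↭ ⟩
        1# * (- 1# * Π rest)        ≡⟨ cong (λ p → 1# * (- 1# * p)) (Π-↭ rest↭) ⟩
        1# * (- 1# * Π (pairs _⁻¹ ys))  ≡⟨ cong (λ p → 1# * (- 1# * p)) (trans (Π-pairs ys y*y⁻¹≡1) (1^n≡1 (length ys))) ⟩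
        1# * (- 1# * 1#)            ≡⟨ solve 0 (# 1 :* (:- # 1 :* # 1) := :- # 1) refl ⟩
        - 1#                        ∎
      where
      open ≡.≡-Reasoning
      y*y⁻¹≡1 : ∀ {y} → y ∈ ys → y * y ⁻¹ ≡ 1#
      y*y⁻¹≡1 y∈ = ⁻¹-inverse _ (rest-nonzero units↭ (∈-resp-↭ (↭-sym rest↭) (∈-pairs y∈)))

    a/x-freeInvolution : ∀ {a} → a ≢ 0# → ¬ IsSquare a → IsFreeInvolutionOn (λ x → a * x ⁻¹) units
    a/x-freeInvolution {a} a≢0 ¬square = record
      { closed           = λ x∈ → ∈-units (*-nonzero a≢0 (⁻¹-nonzero (units-nonzero x∈)))
      ; involutive       = λ {x} x∈ → involutive (units-nonzero x∈)
      ; fixed-point-free = λ {x} x∈ a/x≡x → ¬square (x , linear-combination₂ (- x) a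
          (solve 3 (λ a x x⁻¹ → x :* x :- a := :- x :* (a :* x⁻¹ :- x) :+ a :* (x⁻¹ :* x :- # 1)) refl a x (x ⁻¹))
          a/x≡x (x⁻¹*x≡1 (units-nonzero x∈)))
      }
      where
      involutive : ∀ {x} → x ≢ 0# → a * (a * x ⁻¹) ⁻¹ ≡ x
      involutive {x} x≢0 = begin
        a * (a * x ⁻¹) ⁻¹    ≡⟨ cong (a *_) (⁻¹-unique (linear-combination₂ (x ⁻¹ * x) 1#
                                  (solve 4 (λ a a⁻¹ x x⁻¹ → a :* x⁻¹ :* (a⁻¹ :* x) :- # 1
                                             := x⁻¹ :* x :* (a :* a⁻¹ :- # 1) :+ # 1 :* (x⁻¹ :* x :- # 1)) refl a (a ⁻¹) x (x ⁻¹))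
                                  (⁻¹-inverse a a≢0) (x⁻¹*x≡1 x≢0))) ⟨
        a * (a ⁻¹ * x)       ≡⟨ linear-combination x
                                  (solve 3 (λ a a⁻¹ x → a :* (a⁻¹ :* x) :- x := x :* (a :* a⁻¹ :- # 1)) refl a (a ⁻¹) x)
                                  (⁻¹-inverse a a≢0) ⟩
        x                    ∎
        where open ≡.≡-Reasoning

    euler-criterion : ∀ {a} → a ≢ 0# → IsSquare a ⊎ a ^ h ≡ - 1#
    euler-criterion {a} a≢0 with IsSquare? a
    ... | yes square = inj₁ square
    ... | no ¬square with ys , units↭ ← ↭-pairs units-unique (a/x-freeInvolution a≢0 ¬square) = inj₂ (begin
      a ^ h                           ≡⟨ cong (a ^_) h≡|ys| ⟩
      a ^ length ys                   ≡⟨ Π-pairs ys (λ y∈ → y*[a/y]≡a (units-nonzero (∈-resp-↭ (↭-sym units↭) (∈-pairs y∈)))) ⟨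
      Π (pairs (λ x → a * x ⁻¹) ys)   ≡⟨ Π-↭ units↭ ⟨
      Π units                         ≡⟨ wilson ⟩
      - 1#                            ∎)
      where
      open ≡.≡-Reasoning
      h≡|ys| : h ≡ length ys
      h≡|ys| = ℕ.*-cancelˡ-≡ h (length ys) 2 (trans (sym #units≡2h) (trans (↭-length units↭) (length-pairs _ ys)))
      y*[a/y]≡a : ∀ {y} → y ≢ 0# → y * (a * y ⁻¹) ≡ a
      y*[a/y]≡a {y} y≢0 = linear-combination a
        (solve 3 (λ a y y⁻¹ → y :* (a :* y⁻¹) :- a := a :* (y :* y⁻¹ :- # 1)) refl a y (y ⁻¹)) (⁻¹-inverse y y≢0)

    square⇒^h≡1 : ∀ {a} → a ≢ 0# → IsSquare a → a ^ h ≡ 1#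
    square⇒^h≡1 {a} a≢0 (x , refl) = begin
      (x * x) ^ h      ≡⟨ [x*x]^n≡x^[2n] x h ⟩
      x ^ (2 ℕ.* h)    ≡⟨ cong (x ^_) #units≡2h ⟨
      x ^ #units       ≡⟨ fermat (λ x≡0 → a≢0 (trans (cong (_* x) x≡0) (zeroˡ x))) ⟩
      1#               ∎
      where open ≡.≡-Reasoning

    ^h≡1⇒square : ∀ {a} → a ≢ 0# → a ^ h ≡ 1# → IsSquare a
    ^h≡1⇒square a≢0 a^h≡1 = [ id , (λ a^h≡-1 → contradiction (trans (sym a^h≡1) a^h≡-1) 1≢-1) ]′ (euler-criterion a≢0)

    [-c]^h≡[-1]^h*c^h : ∀ c → (- c) ^ h ≡ (- 1#) ^ h * c ^ h
    [-c]^h≡[-1]^h*c^h c = trans (cong (_^ h) (solve 1 (λ c → :- c := :- # 1 :* c) refl c)) (^-distrib-* (- 1#) c h)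

    [-1]^h≡-1 : ¬ IsSquare (- 1#) → (- 1#) ^ h ≡ - 1#
    [-1]^h≡-1 -1∉□ = [ flip contradiction -1∉□ , id ]′ (euler-criterion -1≢0)

    #sqrts-pair : ¬ IsSquare (- 1#) → ∀ c → #sqrts c ℕ.+ #sqrts (- c) ≡ 2
    #sqrts-pair -1∉□ c with c ≟ 0#
    ... | yes refl = trans (cong (λ d → #sqrts 0# ℕ.+ #sqrts d) -0#≈0#) (cong₂ ℕ._+_ (↭-length sqrts-0) (↭-length sqrts-0))
    ... | no c≢0 with euler-criterion c≢0
    ...   | inj₁ c∈□ = cong₂ ℕ._+_ (#sqrts-square c≢0 c∈□) (cong length (sqrts-nonsquare -c∉□))
      where
      -c∉□ : ¬ IsSquare (- c)
      -c∉□ -c∈□ = 1≢-1 (begin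
        1#                       ≡⟨ square⇒^h≡1 (-‿nonzero c≢0) -c∈□ ⟨
        (- c) ^ h                ≡⟨ [-c]^h≡[-1]^h*c^h c ⟩
        (- 1#) ^ h * c ^ h       ≡⟨ cong₂ _*_ ([-1]^h≡-1 -1∉□) (square⇒^h≡1 c≢0 c∈□) ⟩
        - 1# * 1#                ≡⟨ *-identityʳ (- 1#) ⟩
        - 1#                     ∎)
        where open ≡.≡-Reasoning
    ...   | inj₂ c^h≡-1 = cong₂ ℕ._+_ (cong length (sqrts-nonsquare c∉□)) (#sqrts-square (-‿nonzero c≢0) -c∈□)
      where
      c∉□ : ¬ IsSquare c
      c∉□ c∈□ = 1≢-1 (trans (sym (square⇒^h≡1 c≢0 c∈□)) c^h≡-1)
      -c∈□ : IsSquare (- c)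
      -c∈□ = ^h≡1⇒square (-‿nonzero c≢0) (begin
        (- c) ^ h                ≡⟨ [-c]^h≡[-1]^h*c^h c ⟩
        (- 1#) ^ h * c ^ h       ≡⟨ cong₂ _*_ ([-1]^h≡-1 -1∉□) c^h≡-1 ⟩
        - 1# * - 1#              ≡⟨ solve 0 (:- # 1 :* :- # 1 := # 1) refl ⟩
        1#                       ∎)
        where open ≡.≡-Reasoning

    aLeg[-1]≡0 : ¬ IsSquare (- 1#) → aLeg (- 1#) ≡ ℤ.0ℤ
    aLeg[-1]≡0 -1∉□ = aLeg≡0 (#affine≡size (#sqrts-pair -1∉□) -‿involutive legendre[-1]-twist)

    aLeg[2]≡0 : ¬ IsSquare (- 1#) → aLeg 2# ≡ ℤ.0ℤ
    aLeg[2]≡0 -1∉□ = aLeg≡0 (#affine≡size (#sqrts-pair -1∉□) (c-[c-x]≡x 2#) legendre[2]-twist)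

    aLeg[half]≡0 : ¬ IsSquare (- 1#) → aLeg half ≡ ℤ.0ℤ
    aLeg[half]≡0 -1∉□ = aLeg≡0 (#affine≡size (#sqrts-pair -1∉□) (c-[c-x]≡x 1#) legendre[half]-twist)

    aLeg≡0-if-j≡1728 : ¬ IsSquare (- 1#) → ∀ {l} → l ≢ 0# → l ≢ 1# → jLeg l ≡ fromℕ 1728 → aLeg l ≡ ℤ.0ℤ
    aLeg≡0-if-j≡1728 -1∉□ l≢0 l≢1 j≡1728 =
      [ at (aLeg[-1]≡0 -1∉□) , [ at (aLeg[2]≡0 -1∉□) , at (aLeg[half]≡0 -1∉□) ]′ ]′
        (jLeg≡1728⇒λ≡-1⊎2⊎half l≢0 l≢1 j≡1728)
      where
      at : ∀ {l c} → aLeg c ≡ ℤ.0ℤ → l ≡ c → aLeg l ≡ ℤ.0ℤ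
      at aLeg[c]≡0 l≡c = subst (λ l → aLeg l ≡ ℤ.0ℤ) (sym l≡c) aLeg[c]≡0

    square[-1] : ∀ m → h ≡ 2 ℕ.* m → IsSquare (- 1#)
    square[-1] m h≡2m = ^h≡1⇒square -1≢0 (trans (cong ((- 1#) ^_) h≡2m) ([-1]^[2n]≡1 m))

    nonsquare[-1] : ∀ m → h ≡ suc (2 ℕ.* m) → ¬ IsSquare (- 1#)
    nonsquare[-1] m h≡2m+1 -1∈□ = 1≢-1 (trans (sym (square⇒^h≡1 -1≢0 -1∈□)) (trans (cong ((- 1#) ^_) h≡2m+1) ([-1]^[1+2n]≡-1 m)))

    square[2] : ∀ m → h ≡ 2 ℕ.* (2 ℕ.* m) → IsSquare 2#
    square[2] m h≡4m with i , i²≡-1 ← square[-1] (2 ℕ.* m) h≡4m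
      with z , z²≡i ← ^h≡1⇒square (λ i≡0 → -1≢0 (trans (sym i²≡-1) (trans (cong (_* i) i≡0) (zeroˡ i))))
                       (trans (cong (i ^_) h≡4m) (trans (i^[2k]≡[-1]^k (2 ℕ.* m) i²≡-1) ([-1]^[2n]≡1 m)))
      = z - z * i , √i⇒√2 i²≡-1 z²≡i

    nonsquare[±2] : ∀ m → h ≡ 2 ℕ.* suc (2 ℕ.* m) → ¬ IsSquare 2# × ¬ IsSquare (- 2#)
    nonsquare[±2] m h≡2[2m+1] with i , i²≡-1 ← square[-1] (suc (2 ℕ.* m)) h≡2[2m+1] =
      (λ (u , u²≡2) → nonsquare-root[-1] i²≡-1 (_ , √2⇒√i i²≡-1 u²≡2)) ,
      (λ (u , u²≡-2) → nonsquare-root[-1] (trans (solve 1 (λ i → :- i :* :- i := i :* i) refl i) i²≡-1) (_ , √-2⇒√-i i²≡-1 u²≡-2))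
      where
      nonsquare-root[-1] : ∀ {j} → j * j ≡ - 1# → ¬ IsSquare j
      nonsquare-root[-1] {j} j²≡-1 j∈□ = 1≢-1 (begin
        1#                            ≡⟨ square⇒^h≡1 j≢0 j∈□ ⟨
        j ^ h                         ≡⟨ cong (j ^_) h≡2[2m+1] ⟩
        j ^ (2 ℕ.* suc (2 ℕ.* m))     ≡⟨ i^[2k]≡[-1]^k (suc (2 ℕ.* m)) j²≡-1 ⟩
        (- 1#) ^ suc (2 ℕ.* m)        ≡⟨ [-1]^[1+2n]≡-1 m ⟩
        - 1#                          ∎)
        where
        open ≡.≡-Reasoning
        j≢0 : j ≢ 0#
        j≢0 j≡0 = -1≢0 (trans (sym j²≡-1) (trans (cong (_* j) j≡0) (zeroˡ j)))

open import Data.Nat using (_≤_; _%_; _^_)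
open import Data.Nat.DivMod using (_/_; m≡m%n+[m/n]*n)
open import Data.Nat.Primality using (Prime)
open import Data.Integer using (0ℤ)

private
  open import Data.Nat.Solver using (module +-*-Solver)
  open +-*-Solver

  1+n≡3+4d⇒n≡2[1+2d] : ∀ {n} d → suc n ≡ 3 ℕ.+ d ℕ.* 4 → n ≡ 2 ℕ.* suc (2 ℕ.* d)
  1+n≡3+4d⇒n≡2[1+2d] d eq = trans (ℕ.suc-injective eq)
    (solve 1 (λ d → con 2 :+ d :* con 4 := con 2 :* (con 1 :+ con 2 :* d)) refl d)

  1+n≡1+8d⇒n≡2[2[2d]] : ∀ {n} d → suc n ≡ 1 ℕ.+ d ℕ.* 8 → n ≡ 2 ℕ.* (2 ℕ.* (2 ℕ.* d))
  1+n≡1+8d⇒n≡2[2[2d]] d eq = trans (ℕ.suc-injective eq)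
    (solve 1 (λ d → d :* con 8 := con 2 :* (con 2 :* (con 2 :* d))) refl d)

  1+n≡5+8d⇒n≡2[2[1+2d]] : ∀ {n} d → suc n ≡ 5 ℕ.+ d ℕ.* 8 → n ≡ 2 ℕ.* (2 ℕ.* suc (2 ℕ.* d))
  1+n≡5+8d⇒n≡2[2[1+2d]] d eq = trans (ℕ.suc-injective eq)
    (solve 1 (λ d → con 4 :+ d :* con 8 := con 2 :* (con 2 :* (con 1 :+ con 2 :* d))) refl d)

lemma2p5 : (F : FiniteField) (p k : ℕ) → Prime p → 5 ≤ p → 1 ≤ k →
  FiniteField.size F ≡ p ^ k →
  let open FiniteField F in
  (∀ (l : Carrier) → l ≢ 0# → l ≢ 1# → jLeg l ≡ fromℕ 1728 →
    size % 4 ≡ 3 → aLeg l ≡ 0ℤ)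
  × (size % 8 ≡ 1 → ∀ (b : Carrier) → InL 2# b ⇔ (b ≡ - 1# ⊎ b ≡ 2# ⊎ b ≡ half))
  × (size % 8 ≡ 5 → (∀ (b : Carrier) → InL 2# b ⇔ (b ≡ - 1# ⊎ b ≡ 2#))
               × (∀ (b : Carrier) → InL half b ⇔ b ≡ half))
lemma2p5 F _ _ _ _ _ _ = q≡3[4] , q≡1[8] , q≡5[8]
  where
  open FiniteField F
  open FieldTheory F using (IsSquare; #units; size≡1+#units)

  1+#units≡ : ∀ n .{{_ : NonZero n}} {r} → size % n ≡ r → suc #units ≡ r ℕ.+ size / n ℕ.* n
  1+#units≡ n size%n≡r = trans (sym size≡1+#units) (trans (m≡m%n+[m/n]*n size n) (cong (ℕ._+ size / n ℕ.* n) size%n≡r))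

  q≡3[4] : ∀ l → l ≢ 0# → l ≢ 1# → jLeg l ≡ fromℕ 1728 → size % 4 ≡ 3 → aLeg l ≡ 0ℤ
  q≡3[4] l l≢0 l≢1 j≡1728 q≡3 = aLeg≡0-if-j≡1728 (nonsquare[-1] (size / 4) refl) l≢0 l≢1 j≡1728
    where open FieldTheory.OddOrder F (suc (2 ℕ.* (size / 4))) (1+n≡3+4d⇒n≡2[1+2d] (size / 4) (1+#units≡ 4 q≡3))

  q≡1[8] : size % 8 ≡ 1 → ∀ b → InL 2# b ⇔ (b ≡ - 1# ⊎ b ≡ 2# ⊎ b ≡ half)
  q≡1[8] q≡1 = L[2]-with-√2 (square[2] (size / 8) refl)
    where open FieldTheory.OddOrder F (2 ℕ.* (2 ℕ.* (size / 8))) (1+n≡1+8d⇒n≡2[2[2d]] (size / 8) (1+#units≡ 8 q≡1))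

  q≡5[8] : size % 8 ≡ 5 → (∀ b → InL 2# b ⇔ (b ≡ - 1# ⊎ b ≡ 2#)) × (∀ b → InL half b ⇔ b ≡ half)
  q≡5[8] q≡5 = L[2]-without-√±2 2∉□ -2∉□ , L[half]-without-√±2 2∉□ -2∉□
    where
    open FieldTheory.OddOrder F (2 ℕ.* suc (2 ℕ.* (size / 8))) (1+n≡5+8d⇒n≡2[2[1+2d]] (size / 8) (1+#units≡ 8 q≡5))
    2∉□ : ¬ IsSquare 2#
    2∉□ = proj₁ (nonsquare[±2] (size / 8) refl)
    -2∉□ : ¬ IsSquare (- 2#)
    -2∉□ = proj₂ (nonsquare[±2] (size / 8) refl)
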